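{- Let $n_0\geqslant n_1$ be positive integers, let $P_0$ be a multipacking in $Q_{n_0}$ and $P_1$ a multipacking in $Q_{n_1}$. Let $$n = n_0 + \max(|P_0|,2) + \max(|P_1|,2) - 1,$$ and let $$P = (0^{n-n_0}\cdot P_0)\cup(1^{n-n_1}\cdot P_1)\subseteq\{0,1\}^n.$$ Then $P$ is a multipacking in $Q_n$.
   Context: $Q_m$ is the $m$-dimensional hypercube: vertex set $\{0,1\}^m$ (binary strings of length $m$), two vertices adjacent iff they differ in exactly one coordinate. For $i\in\{0,1\}$ and $m\geqslant 1$, $i^m$ denotes the string of $m$ copies of $i$; for a binary string $x$, $i^m\cdot x$ is the concatenation of $i^m$ followed by $x$, and for a set $S$ of strings, $i^m\cdot S=\{i^m\cdot x : x\in S\}$. For a vertex $v$ and integer $k\geqslant 0$, $N_k[v]$ is the set of vertices at graph distance at most $k$ from $v$. A set $M$ of vertices is a multipacking if $|N_k[v]\cap M|\leqslant k$ for every vertex $v$ and every integer $k\geqslant 1$. -}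

module Defs where

open import Data.Bool using (Bool; true; false)
open import Data.Nat using (ℕ; zero; suc; _+_; _∸_; _⊔_; _≤_; z≤n; s≤s)
open import Data.Nat.Properties using (m≤m+n; m∸n+n≡m; ≤-trans; ∸-monoˡ-≤; +-suc; m≤n⊔m)
open import Data.Fin using (Fin)
open import Data.Vec using (Vec; []; _∷_; lookup; replicate; _++_; cast)
open import Data.List using (List; length; map) renaming (_++_ to _++ₗ_)
open import Data.List.Membership.Propositional using (_∈_)
open import Data.List.Relation.Unary.All using (All)
open import Data.List.Relation.Unary.Unique.Propositional using (Unique)
open import Data.Product using (Σ; ∃; _×_; _,_)
open import Relation.Binary.PropositionalEquality using (_≡_; _≢_; refl; subst; sym)

Vertex : ℕ → Set
Vertex m = Vec Bool m

Adjacent : ∀ {m} → Vertex m → Vertex m → Set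
Adjacent {m} x y =
  Σ (Fin m) λ i → (lookup x i ≢ lookup y i) × (∀ j → j ≢ i → lookup x j ≡ lookup y j)

data Walk {m : ℕ} : ℕ → Vertex m → Vertex m → Set where
  stay : ∀ {x} → Walk zero x x
  step : ∀ {ℓ x y z} → Adjacent x y → Walk ℓ y z → Walk (suc ℓ) x z

InBall : ∀ {m} → ℕ → Vertex m → Vertex m → Set
InBall k v x = ∃ λ ℓ → ℓ ≤ k × Walk ℓ v x

-- A (finite) vertex set M, given as a list, is a multipacking of Q_m:
-- for every vertex v and k ≥ 1, |N_k[v] ∩ M| ≤ k; i.e. every duplicate-free
-- list of elements of N_k[v] ∩ M has length at most k.
Multipacking : ∀ {m} → List (Vertex m) → Set
Multipacking {m} M =
  (v : Vertex m) (k : ℕ) → 1 ≤ k →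
  (L : List (Vertex m)) → Unique L → All (λ x → x ∈ M × InBall k v x) L →
  length L ≤ k

pad : (b : Bool) (n : ℕ) {k : ℕ} → k ≤ n → Vertex k → Vertex n
pad b n {k} k≤n x = cast (m∸n+n≡m k≤n) (replicate (n ∸ k) b ++ x)

dimN : ℕ → ℕ → ℕ → ℕ
dimN n₀ s₀ s₁ = n₀ + (s₀ ⊔ 2) + (s₁ ⊔ 2) ∸ 1

private
  aux : ∀ n a → n ≤ n + suc a ∸ 1
  aux n a rewrite +-suc n a = m≤m+n n a

n₀≤dimN : ∀ n₀ s₀ s₁ → n₀ ≤ dimN n₀ s₀ s₁
n₀≤dimN n₀ s₀ s₁ with s₀ ⊔ 2 | m≤n⊔m s₀ 2
... | suc a | _ = ≤-trans (aux n₀ a) (∸-monoˡ-≤ 1 (m≤m+n (n₀ + suc a) (s₁ ⊔ 2)))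

n₁≤dimN : ∀ {n₁} n₀ s₀ s₁ → n₁ ≤ n₀ → n₁ ≤ dimN n₀ s₀ s₁
n₁≤dimN n₀ s₀ s₁ h = ≤-trans h (n₀≤dimN n₀ s₀ s₁)

combine : ∀ n₀ n₁ → n₁ ≤ n₀ → (P₀ : List (Vertex n₀)) (P₁ : List (Vertex n₁)) →
          List (Vertex (dimN n₀ (length P₀) (length P₁)))
combine n₀ n₁ h P₀ P₁ =
  map (pad false n (n₀≤dimN n₀ (length P₀) (length P₁))) P₀
  ++ₗ map (pad true n (n₁≤dimN n₀ (length P₀) (length P₁) h)) P₁
  where n = dimN n₀ (length P₀) (length P₁)

{-# OPTIONS --safe #-}

-- Write a vertex v of Q_n as u · w with |u| = a = n − n₀, and let c₀ = d(u, 0^a) and c₁ = d(u, 1^a),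
-- so that c₀ + c₁ = a. A point 0^a · x of the first copy lies at distance c₀ + d(w, x) from v, and a
-- point of the second copy at distance at least c₁ + d(w′, y), where w′ is the last n₁ bits of v.
-- So N_k[v] meets the i-th copy in at most k − cᵢ points if cᵢ < k, at most one if cᵢ = k and none
-- if cᵢ > k, and in at most |Pᵢ| points anyway. As a + 1 = max(|P₀|,2) + max(|P₁|,2), a short case
-- analysis on these bounds leaves at most k points in total.

module Submission where

open import Defs
open import Data.Nat using (ℕ; zero; suc; _+_; _∸_; _≤_; _⊔_; z≤n; s≤s; _≤?_)
open import Data.List using (List; []; _∷_; length; map)
open import Data.List.Relation.Unary.Unique.Propositional using (Unique)

open import Data.Bool using (Bool; true; false)
open import Data.Nat.Properties
open import Algebra.Properties.CommutativeSemigroup +-commutativeSemigroup using (interchange)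
open import Data.Fin using () renaming (zero to fzero; suc to fsuc)
open import Data.Fin.Properties using () renaming (suc-injective to fsuc-injective)
open import Data.Vec using ([]; _∷_; lookup; replicate; _++_; cast; take; drop; toList)
open import Data.Vec.Properties
  using (cast-is-id; cast-trans; take++drop≡id; toList-injective; toList-cast; toList-++; toList-replicate;
         tabulate∘lookup; tabulate-cong)
import Data.List as List
open import Data.List.Properties using (++-assoc; length-removeAt′)
open import Data.List.Relation.Unary.All as All using (All; []; _∷_)
open import Data.List.Relation.Unary.Any using (here; there; _─_)
open import Data.List.Relation.Unary.AllPairs using ([]; _∷_)
open import Data.List.Membership.Propositional using (_∈_)
open import Data.List.Membership.Propositional.Properties using (∈-++⁻; ∈-map⁻)
open import Data.Product using (_×_; _,_; proj₁; proj₂; map₂)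
open import Data.Sum using (inj₁; inj₂)
open import Data.Empty using (⊥-elim)
open import Relation.Nullary using (yes; no)
open import Relation.Binary.PropositionalEquality
open import Function using (_∘′_)

private
  variable
    A B C : Set
    b : Bool
    m n k c : ℕ

mismatch : Bool → Bool → ℕ
mismatch false false = 0
mismatch true  true  = 0
mismatch false true  = 1
mismatch true  false = 1

mismatch-refl : ∀ a → mismatch a a ≡ 0
mismatch-refl false = refl
mismatch-refl true  = refl

mismatch≤1 : ∀ a b → mismatch a b ≤ 1
mismatch≤1 false false = z≤n
mismatch≤1 true  true  = z≤n
mismatch≤1 false true  = ≤-refl
mismatch≤1 true  false = ≤-refl

hamming : Vertex m → Vertex m → ℕ
hamming []      []      = 0
hamming (a ∷ x) (b ∷ y) = mismatch a b + hamming x y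

hamming-refl : (x : Vertex m) → hamming x x ≡ 0
hamming-refl []      = refl
hamming-refl (a ∷ x) = cong₂ _+_ (mismatch-refl a) (hamming-refl x)

hamming-++ : (u u′ : Vertex m) (w w′ : Vertex n) →
             hamming (u ++ w) (u′ ++ w′) ≡ hamming u u′ + hamming w w′
hamming-++ []      []       w w′ = refl
hamming-++ (a ∷ u) (b ∷ u′) w w′ =
  trans (cong (mismatch a b +_) (hamming-++ u u′ w w′)) (sym (+-assoc (mismatch a b) _ _))

hamming-cast : .(eq : m ≡ n) (x y : Vertex m) → hamming (cast eq x) (cast eq y) ≡ hamming x y
hamming-cast {zero}  {zero}  eq []      []      = refl
hamming-cast {suc _} {suc _} eq (a ∷ x) (b ∷ y) =
  cong (mismatch a b +_) (hamming-cast (suc-injective eq) x y)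

hamming-false+true : (u : Vertex m) → hamming u (replicate m false) + hamming u (replicate m true) ≡ m
hamming-false+true []        = refl
hamming-false+true (true ∷ u)  = cong suc (hamming-false+true u)
hamming-false+true (false ∷ u) =
  trans (+-suc (hamming u (replicate _ false)) _) (cong suc (hamming-false+true u))

lookup-ext : {x y : Vertex m} → (∀ i → lookup x i ≡ lookup y i) → x ≡ y
lookup-ext {x = x} {y} same =
  trans (sym (tabulate∘lookup x)) (trans (tabulate-cong same) (tabulate∘lookup y))

hamming-adjacent : {x y z : Vertex m} → Adjacent x y → hamming x z ≤ suc (hamming y z)
hamming-adjacent {x = a ∷ x} {b ∷ y} {c ∷ z} (fzero , _ , same) =
  begin
    mismatch a c + hamming x z ≡⟨ cong (λ t → mismatch a c + hamming t z) x≡y ⟩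
    mismatch a c + hamming y z ≤⟨ +-monoˡ-≤ (hamming y z) (mismatch≤1 a c) ⟩
    suc (hamming y z)          ≤⟨ s≤s (m≤n+m (hamming y z) (mismatch b c)) ⟩
    suc (mismatch b c + hamming y z) ∎
  where
    open ≤-Reasoning
    x≡y : x ≡ y
    x≡y = lookup-ext (λ j → same (fsuc j) λ ())
hamming-adjacent {x = a ∷ x} {b ∷ y} {c ∷ z} (fsuc i , differ , same) =
  begin
    mismatch a c + hamming x z         ≡⟨ cong (λ t → mismatch t c + hamming x z) (same fzero λ ()) ⟩
    mismatch b c + hamming x z         ≤⟨ +-monoʳ-≤ (mismatch b c) (hamming-adjacent {x = x} {y} {z} tail-adjacent) ⟩
    mismatch b c + suc (hamming y z)   ≡⟨ +-suc (mismatch b c) (hamming y z) ⟩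
    suc (mismatch b c + hamming y z)   ∎
  where
    open ≤-Reasoning
    tail-adjacent : Adjacent x y
    tail-adjacent = i , differ , λ j j≢i → same (fsuc j) (j≢i ∘′ fsuc-injective)

hamming-walk : {x y : Vertex m} → Walk n x y → hamming x y ≤ n
hamming-walk {x = x} stay = ≤-reflexive (hamming-refl x)
hamming-walk {x = x} {z} (step {y = y} adj walk) =
  ≤-trans (hamming-adjacent {x = x} {y} {z} adj) (s≤s (hamming-walk walk))

∷-adjacent : ∀ a {x y : Vertex m} → Adjacent x y → Adjacent (a ∷ x) (a ∷ y)
∷-adjacent a (i , differ , same) =
  fsuc i , differ , λ { fzero _ → refl ; (fsuc j) j≢i → same j (λ j≡i → j≢i (cong fsuc j≡i)) }

∷-walk : ∀ a {x y : Vertex m} → Walk n x y → Walk n (a ∷ x) (a ∷ y)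
∷-walk a stay            = stay
∷-walk a (step adj walk) = step (∷-adjacent a adj) (∷-walk a walk)

flip-adjacent : ∀ {a b} → a ≢ b → (x : Vertex m) → Adjacent (a ∷ x) (b ∷ x)
flip-adjacent a≢b x = fzero , a≢b , λ { fzero 0≢0 → ⊥-elim (0≢0 refl) ; (fsuc j) _ → refl }

geodesic : (x y : Vertex m) → Walk (hamming x y) x y
geodesic []          []          = stay
geodesic (false ∷ x) (false ∷ y) = ∷-walk false (geodesic x y)
geodesic (true ∷ x)  (true ∷ y)  = ∷-walk true (geodesic x y)
geodesic (false ∷ x) (true ∷ y)  = step (flip-adjacent (λ ()) x) (∷-walk true (geodesic x y))
geodesic (true ∷ x)  (false ∷ y) = step (flip-adjacent (λ ()) x) (∷-walk false (geodesic x y))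

inBall⇒hamming≤ : {v x : Vertex m} → InBall k v x → hamming v x ≤ k
inBall⇒hamming≤ (_ , ℓ≤k , walk) = ≤-trans (hamming-walk walk) ℓ≤k

hamming≤⇒inBall : {v x : Vertex m} → hamming v x ≤ k → InBall k v x
hamming≤⇒inBall {v = v} {x} d≤k = hamming v x , d≤k , geodesic v x

prefix : k ≤ n → Vertex n → Vertex (n ∸ k)
prefix {k} {n} k≤n v = take (n ∸ k) (cast (sym (m∸n+n≡m k≤n)) v)

suffix : k ≤ n → Vertex n → Vertex k
suffix {k} {n} k≤n v = drop (n ∸ k) (cast (sym (m∸n+n≡m k≤n)) v)

hamming-pad : (k≤n : k ≤ n) (v : Vertex n) (x : Vertex k) →
              hamming v (pad b n k≤n x) ≡ hamming (prefix k≤n v) (replicate (n ∸ k) b) + hamming (suffix k≤n v) x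
hamming-pad {k} {n} {b} k≤n v x = begin
  hamming v (cast eq (replicate (n ∸ k) b ++ x))
    ≡⟨ cong (λ t → hamming t (cast eq (replicate (n ∸ k) b ++ x))) (sym v≡) ⟩
  hamming (cast eq v′) (cast eq (replicate (n ∸ k) b ++ x))
    ≡⟨ hamming-cast eq v′ _ ⟩
  hamming v′ (replicate (n ∸ k) b ++ x)
    ≡⟨ cong (λ t → hamming t (replicate (n ∸ k) b ++ x)) (sym (take++drop≡id (n ∸ k) v′)) ⟩
  hamming (take (n ∸ k) v′ ++ drop (n ∸ k) v′) (replicate (n ∸ k) b ++ x)
    ≡⟨ hamming-++ (take (n ∸ k) v′) _ (drop (n ∸ k) v′) x ⟩
  hamming (prefix k≤n v) (replicate (n ∸ k) b) + hamming (suffix k≤n v) x ∎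
  where
    open ≡-Reasoning
    eq = m∸n+n≡m k≤n
    v′ = cast (sym eq) v
    v≡ : cast eq v′ ≡ v
    v≡ = trans (cast-trans (sym eq) eq v) (cast-is-id _ v)

hamming-suffix≤ : (k≤n : k ≤ n) (v : Vertex n) (x : Vertex k) →
                  hamming (suffix k≤n v) x ≤ hamming v (pad b n k≤n x)
hamming-suffix≤ k≤n v x =
  subst (hamming (suffix k≤n v) x ≤_) (sym (hamming-pad k≤n v x)) (m≤n+m _ _)

replicate-++ : ∀ m n (a : A) → List.replicate m a List.++ List.replicate n a ≡ List.replicate (m + n) a
replicate-++ zero    n a = refl
replicate-++ (suc m) n a = cong (a ∷_) (replicate-++ m n a)

toList-pad : (k≤n : k ≤ n) (x : Vertex k) → toList (pad b n k≤n x) ≡ List.replicate (n ∸ k) b List.++ toList x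
toList-pad {k} {n} {b} k≤n x = begin
  toList (cast _ (replicate (n ∸ k) b ++ x))        ≡⟨ toList-cast _ (replicate (n ∸ k) b ++ x) ⟩
  toList (replicate (n ∸ k) b ++ x)                 ≡⟨ toList-++ (replicate (n ∸ k) b) x ⟩
  toList (replicate (n ∸ k) b) List.++ toList x     ≡⟨ cong (List._++ toList x) (toList-replicate (n ∸ k) b) ⟩
  List.replicate (n ∸ k) b List.++ toList x         ∎
  where open ≡-Reasoning

pad-trans : ∀ {n₀ n₁ N} (n₁≤n₀ : n₁ ≤ n₀) (n₀≤N : n₀ ≤ N) (n₁≤N : n₁ ≤ N) (y : Vertex n₁) →
            pad b N n₀≤N (pad b n₀ n₁≤n₀ y) ≡ pad b N n₁≤N y
pad-trans {b} {n₀} {n₁} {N} n₁≤n₀ n₀≤N n₁≤N y =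
  trans (sym (cast-is-id refl _)) (toList-injective refl _ _ (begin
    toList (pad b N n₀≤N (pad b n₀ n₁≤n₀ y))
      ≡⟨ toList-pad n₀≤N _ ⟩
    List.replicate (N ∸ n₀) b List.++ toList (pad b n₀ n₁≤n₀ y)
      ≡⟨ cong (List.replicate (N ∸ n₀) b List.++_) (toList-pad n₁≤n₀ y) ⟩
    List.replicate (N ∸ n₀) b List.++ (List.replicate (n₀ ∸ n₁) b List.++ toList y)
      ≡⟨ ++-assoc (List.replicate (N ∸ n₀) b) _ _ ⟨
    (List.replicate (N ∸ n₀) b List.++ List.replicate (n₀ ∸ n₁) b) List.++ toList y
      ≡⟨ cong (List._++ toList y) (replicate-++ (N ∸ n₀) (n₀ ∸ n₁) b) ⟩
    List.replicate ((N ∸ n₀) + (n₀ ∸ n₁)) b List.++ toList y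
      ≡⟨ cong (λ j → List.replicate j b List.++ toList y) gaps ⟩
    List.replicate (N ∸ n₁) b List.++ toList y
      ≡⟨ toList-pad n₁≤N y ⟨
    toList (pad b N n₁≤N y) ∎))
  where
    open ≡-Reasoning
    gaps : (N ∸ n₀) + (n₀ ∸ n₁) ≡ N ∸ n₁
    gaps = trans (sym (+-∸-assoc (N ∸ n₀) n₁≤n₀)) (cong (_∸ n₁) (m∸n+n≡m n₀≤N))

∈-─ : {x y : A} {P : List A} (x∈P : x ∈ P) → y ∈ P → x ≢ y → y ∈ (P ─ x∈P)
∈-─ (here refl) (here refl) x≢y = ⊥-elim (x≢y refl)
∈-─ (here _)    (there y∈P) _   = y∈P
∈-─ (there _)   (here y≡p)  _   = here y≡p
∈-─ (there x∈P) (there y∈P) x≢y = there (∈-─ x∈P y∈P x≢y)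

unique⊆⇒length≤ : {L P : List A} → Unique L → All (_∈ P) L → length L ≤ length P
unique⊆⇒length≤ []           []           = z≤n
unique⊆⇒length≤ {P = P} (x∉L ∷ uL) (x∈P ∷ L⊆P) =
  subst (_ ≤_) (sym (length-removeAt′ P _))
    (s≤s (unique⊆⇒length≤ uL (All.zipWith (λ (x≢y , y∈P) → ∈-─ x∈P y∈P x≢y) (x∉L , L⊆P))))

record Preimages (f : A → C) (g : B → C) (P : List A) (R : List B) (L : List C) : Set where
  field
    left         : List A
    right        : List B
    left-unique  : Unique left
    right-unique : Unique right
    left⊆        : All (λ x → x ∈ P × f x ∈ L) left
    right⊆       : All (λ y → y ∈ R × g y ∈ L) right
    length-split : length L ≡ length left + length right

fresh-preimage : (f : A → C) {x : A} {L : List C} {xs : List A} →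
                 All (f x ≢_) L → All (λ x′ → f x′ ∈ L) xs → All (x ≢_) xs
fresh-preimage f fx∉L = All.map (λ fx′∈L x≡x′ → All.lookup fx∉L fx′∈L (cong f x≡x′))

preimages : (f : A → C) (g : B → C) {P : List A} {R : List B} {L : List C} →
            Unique L → All (_∈ map f P List.++ map g R) L → Preimages f g P R L
preimages f g [] [] = record
  { left = [] ; right = [] ; left-unique = [] ; right-unique = []
  ; left⊆ = [] ; right⊆ = [] ; length-split = refl }
preimages f g {P} (z∉L ∷ uL) (z∈ ∷ L⊆) with preimages f g uL L⊆ | ∈-++⁻ (map f P) z∈
... | r | inj₁ z∈fP with ∈-map⁻ f z∈fP
...   | x , x∈P , refl = record
  { left = x ∷ left ; right = right
  ; left-unique = fresh-preimage f z∉L (All.map proj₂ left⊆) ∷ left-unique ; right-unique = right-unique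
  ; left⊆ = (x∈P , here refl) ∷ All.map (map₂ there) left⊆
  ; right⊆ = All.map (map₂ there) right⊆
  ; length-split = cong suc length-split }
  where open Preimages r
preimages f g (z∉L ∷ uL) (z∈ ∷ L⊆) | r | inj₂ z∈gR with ∈-map⁻ g z∈gR
...   | y , y∈R , refl = record
  { left = left ; right = y ∷ right
  ; left-unique = left-unique ; right-unique = fresh-preimage g z∉L (All.map proj₂ right⊆) ∷ right-unique
  ; left⊆ = All.map (map₂ there) left⊆
  ; right⊆ = (y∈R , here refl) ∷ All.map (map₂ there) right⊆
  ; length-split = trans (cong suc length-split) (sym (+-suc (length left) (length right))) }
  where open Preimages r

-- The possible sizes m of a duplicate-free set of multipacking points x with c + d(w, x) ≤ k.
data SubcubeCount (k c : ℕ) : ℕ → Set where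
  none   : SubcubeCount k c 0
  inside : ∀ {m} → m + c ≤ k → SubcubeCount k c m
  centre : ∀ {m} → m ≤ 1 → c ≡ k → SubcubeCount k c m

multipacking-ball : {M L : List (Vertex m)} → Multipacking M → (w : Vertex m) → 1 ≤ k → Unique L →
                    All (λ x → x ∈ M × hamming w x ≤ k) L → length L ≤ k
multipacking-ball mp w 1≤k uL L⊆ =
  mp w _ 1≤k _ uL (All.map (λ (x∈M , d≤k) → x∈M , hamming≤⇒inBall d≤k) L⊆)

offset-ball : {M L : List (Vertex m)} (c : ℕ) (w : Vertex m) →
              All (λ x → x ∈ M × c + hamming w x ≤ k) L → All (λ x → x ∈ M × hamming w x ≤ k ∸ c) L
offset-ball {k = k} c w = All.map (map₂ λ c+d≤k → m+n≤o⇒m≤o∸n _ (subst (_≤ k) (+-comm c _) c+d≤k))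

subcubeCount : {M L : List (Vertex m)} → Multipacking M → (w : Vertex m) → Unique L →
               All (λ x → x ∈ M × c + hamming w x ≤ k) L → SubcubeCount k c (length L)
subcubeCount mp w [] [] = none
subcubeCount {c = c} {k} {L = L} mp w uL L⊆@((_ , c+d≤k) ∷ _)
  with m≤n⇒m<n∨m≡n (m+n≤o⇒m≤o c c+d≤k)
... | inj₁ c<k = inside (m≤o∸n⇒m+n≤o (length L) (<⇒≤ c<k) L≤k∸c)
  where
    L≤k∸c : length L ≤ k ∸ c
    L≤k∸c = multipacking-ball mp w (m<n⇒0<n∸m c<k) uL (offset-ball c w L⊆)
... | inj₂ refl = centre L≤1 refl
  where
    c∸c≤1 : c ∸ c ≤ 1
    c∸c≤1 = subst (_≤ 1) (sym (n∸n≡0 c)) z≤n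
    L≤1 : length L ≤ 1
    L≤1 = multipacking-ball mp w ≤-refl uL (All.map (map₂ (λ d≤c∸c → ≤-trans d≤c∸c c∸c≤1)) (offset-ball c w L⊆))

subcubeCount≤ : ∀ {m} → 1 ≤ k → SubcubeCount k c m → m ≤ k
subcubeCount≤ _   none            = z≤n
subcubeCount≤ _   (inside m+c≤k)  = m+n≤o⇒m≤o _ m+c≤k
subcubeCount≤ 1≤k (centre m≤1 _)  = ≤-trans m≤1 1≤k

3≤n+n⇒2≤n : 3 ≤ n + n → 2 ≤ n
3≤n+n⇒2≤n {suc zero}    (s≤s (s≤s ()))
3≤n+n⇒2≤n {suc (suc n)} _ = s≤s (s≤s z≤n)

inside+centre : ∀ {a₀ a₁ c₀ m₀ m₁} → 2 ≤ a₁ → suc (c₀ + k) ≡ a₀ + a₁ → m₀ ≤ a₀ →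
                m₀ + c₀ ≤ k → m₁ ≤ 1 → m₀ + m₁ ≤ k
inside+centre {k} {a₀} {a₁} {zero} {m₀} {m₁} 2≤a₁ total m₀≤a₀ _ m₁≤1 = begin
  m₀ + m₁   ≤⟨ +-mono-≤ m₀≤a₀ m₁≤1 ⟩
  a₀ + 1    ≤⟨ ≤-pred (begin
    suc (a₀ + 1) ≡⟨ +-suc a₀ 1 ⟨
    a₀ + 2       ≤⟨ +-monoʳ-≤ a₀ 2≤a₁ ⟩
    a₀ + a₁      ≡⟨ total ⟨
    suc k        ∎) ⟩
  k         ∎
  where open ≤-Reasoning
inside+centre {c₀ = suc _} {m₀} _ _ _ m₀+c₀≤k m₁≤1 =
  ≤-trans (+-monoʳ-≤ m₀ (≤-trans m₁≤1 (s≤s z≤n))) m₀+c₀≤k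

subcubeCount-+ : ∀ {a₀ a₁ c₀ c₁ m₀ m₁} → 1 ≤ k → 2 ≤ a₀ → 2 ≤ a₁ → suc (c₀ + c₁) ≡ a₀ + a₁ →
                 m₀ ≤ a₀ → m₁ ≤ a₁ → SubcubeCount k c₀ m₀ → SubcubeCount k c₁ m₁ → m₀ + m₁ ≤ k
subcubeCount-+ 1≤k _ _ _ _ _ none C₁ = subcubeCount≤ 1≤k C₁
subcubeCount-+ {m₀ = m₀} 1≤k _ _ _ _ _ C₀ none = subst (_≤ _) (sym (+-identityʳ m₀)) (subcubeCount≤ 1≤k C₀)
subcubeCount-+ {k} {a₀} {a₁} {c₀} {c₁} {m₀} {m₁} _ _ _ total m₀≤a₀ m₁≤a₁ (inside h₀) (inside h₁)
  with k ≤? c₀ + c₁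
... | yes k≤c₀+c₁ = +-cancelʳ-≤ (c₀ + c₁) _ _ (begin
  m₀ + m₁ + (c₀ + c₁)    ≡⟨ interchange m₀ m₁ c₀ c₁ ⟩
  (m₀ + c₀) + (m₁ + c₁)  ≤⟨ +-mono-≤ h₀ h₁ ⟩
  k + k                  ≤⟨ +-monoʳ-≤ k k≤c₀+c₁ ⟩
  k + (c₀ + c₁)          ∎)
  where open ≤-Reasoning
... | no k≰c₀+c₁ = begin
  m₀ + m₁        ≤⟨ +-mono-≤ m₀≤a₀ m₁≤a₁ ⟩
  a₀ + a₁        ≡⟨ total ⟨
  suc (c₀ + c₁)  ≤⟨ ≰⇒> k≰c₀+c₁ ⟩
  k              ∎
  where open ≤-Reasoning
subcubeCount-+ _ _ 2≤a₁ total m₀≤a₀ _ (inside h₀) (centre m₁≤1 refl) =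
  inside+centre 2≤a₁ total m₀≤a₀ h₀ m₁≤1
subcubeCount-+ {a₀ = a₀} {a₁} {c₀} {c₁} {m₀} {m₁} _ 2≤a₀ _ total _ m₁≤a₁
               (centre m₀≤1 refl) (inside h₁) =
  subst (_≤ c₀) (+-comm m₁ m₀)
    (inside+centre 2≤a₀ (trans (cong suc (+-comm c₁ c₀)) (trans total (+-comm a₀ a₁))) m₁≤a₁ h₁ m₀≤1)
subcubeCount-+ _ 2≤a₀ 2≤a₁ total _ _ (centre m₀≤1 refl) (centre m₁≤1 refl) =
  ≤-trans (+-mono-≤ m₀≤1 m₁≤1) (3≤n+n⇒2≤n (≤-pred (subst (4 ≤_) (sym total) (+-mono-≤ 2≤a₀ 2≤a₁))))

hamming-nested-pad : ∀ {n₀ n₁ N} (n₁≤n₀ : n₁ ≤ n₀) (n₀≤N : n₀ ≤ N) (n₁≤N : n₁ ≤ N)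
                     (v : Vertex N) (y : Vertex n₁) →
                     hamming (prefix n₀≤N v) (replicate (N ∸ n₀) b) + hamming (suffix n₁≤n₀ (suffix n₀≤N v)) y
                       ≤ hamming v (pad b N n₁≤N y)
hamming-nested-pad {b} {n₀} {n₁} {N} n₁≤n₀ n₀≤N n₁≤N v y = begin
  hamming (prefix n₀≤N v) (replicate (N ∸ n₀) b) + hamming (suffix n₁≤n₀ w) y
    ≤⟨ +-monoʳ-≤ _ (hamming-suffix≤ n₁≤n₀ w y) ⟩
  hamming (prefix n₀≤N v) (replicate (N ∸ n₀) b) + hamming w (pad b n₀ n₁≤n₀ y)
    ≡⟨ hamming-pad n₀≤N v _ ⟨
  hamming v (pad b N n₀≤N (pad b n₀ n₁≤n₀ y))
    ≡⟨ cong (hamming v) (pad-trans n₁≤n₀ n₀≤N n₁≤N y) ⟩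
  hamming v (pad b N n₁≤N y) ∎
  where
    open ≤-Reasoning
    w = suffix n₀≤N v

suc[dimN∸n₀] : ∀ n₀ s₀ s₁ → suc (dimN n₀ s₀ s₁ ∸ n₀) ≡ (s₀ ⊔ 2) + (s₁ ⊔ 2)
suc[dimN∸n₀] n₀ s₀ s₁ = gap (s₀ ⊔ 2) (s₁ ⊔ 2) (≤-trans (s≤s z≤n) (m≤n⊔m s₀ 2))
  where
    open ≡-Reasoning
    gap : ∀ a b → 1 ≤ a → suc (n₀ + a + b ∸ 1 ∸ n₀) ≡ a + b
    gap (suc a) b _ = cong suc (begin
      n₀ + suc a + b ∸ 1 ∸ n₀  ≡⟨ cong (λ t → t ∸ 1 ∸ n₀) (trans (+-assoc n₀ (suc a) b) (+-suc n₀ (a + b))) ⟩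
      n₀ + (a + b) ∸ n₀        ≡⟨ m+n∸m≡n n₀ (a + b) ⟩
      a + b                    ∎)

lemma1 : (n₀ n₁ : ℕ) → 1 ≤ n₁ → (h : n₁ ≤ n₀) →
         (P₀ : List (Vertex n₀)) (P₁ : List (Vertex n₁)) →
         Unique P₀ → Unique P₁ →
         Multipacking P₀ → Multipacking P₁ →
         Multipacking (combine n₀ n₁ h P₀ P₁)
lemma1 n₀ n₁ _ n₁≤n₀ P₀ P₁ _ _ mp₀ mp₁ v k 1≤k L uL L⊆ = begin
  length L                    ≡⟨ length-split ⟩
  length left + length right  ≤⟨ subcubeCount-+ 1≤k (m≤n⊔m s₀ 2) (m≤n⊔m s₁ 2) total
                                   (size-bound left-unique left⊆) (size-bound right-unique right⊆)
                                   (subcubeCount mp₀ w left-unique (All.map near₀ left⊆))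
                                   (subcubeCount mp₁ (suffix n₁≤n₀ w) right-unique (All.map near₁ right⊆)) ⟩
  k                           ∎
  where
    open ≤-Reasoning
    s₀ = length P₀
    s₁ = length P₁
    N = dimN n₀ s₀ s₁
    n₀≤N = n₀≤dimN n₀ s₀ s₁
    n₁≤N = n₁≤dimN n₀ s₀ s₁ n₁≤n₀
    open Preimages (preimages (pad false N n₀≤N) (pad true N n₁≤N) {P₀} {P₁} uL (All.map proj₁ L⊆))
    w = suffix n₀≤N v
    c₀ = hamming (prefix n₀≤N v) (replicate (N ∸ n₀) false)
    c₁ = hamming (prefix n₀≤N v) (replicate (N ∸ n₀) true)
    total : suc (c₀ + c₁) ≡ (s₀ ⊔ 2) + (s₁ ⊔ 2)
    total = trans (cong suc (hamming-false+true (prefix n₀≤N v))) (suc[dimN∸n₀] n₀ s₀ s₁)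
    size-bound : ∀ {n} {P Q : List (Vertex n)} {X : Vertex n → Set} →
                 Unique Q → All (λ x → x ∈ P × X x) Q → length Q ≤ (length P) ⊔ 2
    size-bound uQ Q⊆ = ≤-trans (unique⊆⇒length≤ uQ (All.map proj₁ Q⊆)) (m≤m⊔n _ 2)
    near : ∀ {z} → z ∈ L → hamming v z ≤ k
    near z∈L = inBall⇒hamming≤ (proj₂ (All.lookup L⊆ z∈L))
    near₀ : ∀ {x} → x ∈ P₀ × pad false N n₀≤N x ∈ L → x ∈ P₀ × c₀ + hamming w x ≤ k
    near₀ {x} (x∈P₀ , x∈L) = x∈P₀ , subst (_≤ k) (hamming-pad n₀≤N v x) (near x∈L)
    near₁ : ∀ {y} → y ∈ P₁ × pad true N n₁≤N y ∈ L → y ∈ P₁ × c₁ + hamming (suffix n₁≤n₀ w) y ≤ k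
    near₁ {y} (y∈P₁ , y∈L) = y∈P₁ , ≤-trans (hamming-nested-pad n₁≤n₀ n₀≤N n₁≤N v y) (near y∈L)
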